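{- Let $I\subseteq[n]$, $\overline J\subseteq[\overline n]$ be a valid pair. For any two vertices $v<w$ of the directed graph $G(I,\overline J)$ there exists at most one directed path from $v$ to $w$ in $G(I,\overline J)$.
   Context: Fix $n\ge1$, $[n]=\{1,\dots,n\}$, $[\overline n]=\{\overline1,\dots,\overline n\}$, totally ordered by $1\prec\overline1\prec2\prec\overline2\prec\cdots\prec n\prec\overline n$. A pair $I\subseteq[n]$, $\overline J\subseteq[\overline n]$ is valid if $\min(I\sqcup\overline J)\in I$ and $\max(I\sqcup\overline J)\in\overline J$ (w.r.t. $\prec$). Define $\mathrm{prec}:\overline J\to[n]$: if in $\prec$ restricted to $I\sqcup\overline J$ the element $\overline j$ is immediately preceded by some $i\in I$, then $\mathrm{prec}(\overline j)=i$; otherwise $\mathrm{prec}(\overline j)=j$. Let $\mathrm{prec}(A(I,\overline J))$ be the simple directed graph on vertex set $I\cup\mathrm{prec}(\overline J)\subseteq[n]$ with edges $(i,\mathrm{prec}(\overline j))$ for all $i\in I$, $\overline j\in\overline J$ with $i<\mathrm{prec}(\overline j)$ (it is the quotient of the graph on $I\sqcup\overline J$ with arcs $(i,\overline j)$, $i\prec\overline j$, obtained by identifying $\overline j$ with $\mathrm{prec}(\overline j)$). For a simple directed graph $H$ on a subset of $[n]$ with edges directed from smaller to larger vertex, $\min(H)$ is obtained by deleting each edge $(i,j)$ for which $H$ contains a directed path $i,i_1,\dots,i_k,j$ with $k\ge1$. Define $G(I,\overline J)=\min(\mathrm{prec}(A(I,\overline J)))$. -}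

module Defs where

open import Data.Nat using (ℕ; _+_; _*_; _≤_; _<_)
open import Data.Fin using (Fin; toℕ)
open import Data.Fin.Subset using (Subset; _∈_)
open import Data.Sum using (_⊎_; inj₁; inj₂)
open import Data.Product using (Σ; _×_; ∃; ∃-syntax)
open import Data.List using (List; []; _∷_; length)
open import Relation.Nullary using (¬_)
open import Relation.Binary.PropositionalEquality using (_≡_)

-- Elements of [n] ⊔ [n̄]; index k : Fin n stands for the number k+1.
-- inj₁ i  is the unbarred element i,  inj₂ j  is the barred element j̄.
Elem : ℕ → Set
Elem n = Fin n ⊎ Fin n

-- position in the total order 1 ≺ 1̄ ≺ 2 ≺ 2̄ ≺ ⋯
key : ∀ {n} → Elem n → ℕ
key (inj₁ i) = 2 * toℕ i
key (inj₂ j) = 2 * toℕ j + 1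

_≺_ : ∀ {n} → Elem n → Elem n → Set
x ≺ y = key x < key y

_≼_ : ∀ {n} → Elem n → Elem n → Set
x ≼ y = key x ≤ key y

InS : ∀ {n} → Subset n → Subset n → Elem n → Set
InS I J (inj₁ i) = i ∈ I
InS I J (inj₂ j) = j ∈ J

Valid : ∀ {n} → Subset n → Subset n → Set
Valid I J =
  (∃[ i ] (i ∈ I × (∀ x → InS I J x → inj₁ i ≼ x))) ×
  (∃[ j ] (j ∈ J × (∀ x → InS I J x → x ≼ inj₂ j)))

ImmPred : ∀ {n} → Subset n → Subset n → Elem n → Elem n → Set
ImmPred I J x y = InS I J x × x ≺ y × (¬ (∃[ z ] (InS I J z × x ≺ z × z ≺ y)))

-- Prec I J j k : "prec(j̄) = k" (the graph of the function prec : J̄ → [n])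
Prec : ∀ {n} → Subset n → Subset n → Fin n → Fin n → Set
Prec I J j k =
  (ImmPred I J (inj₁ k) (inj₂ j)) ⊎
  ((¬ (∃[ i ] ImmPred I J (inj₁ i) (inj₂ j))) × k ≡ j)

PrecAVertex : ∀ {n} → Subset n → Subset n → Fin n → Set
PrecAVertex I J v = v ∈ I ⊎ (∃[ j ] (j ∈ J × Prec I J j v))

PrecAEdge : ∀ {n} → Subset n → Subset n → Fin n → Fin n → Set
PrecAEdge I J u w =
  u ∈ I × (∃[ j ] (j ∈ J × Prec I J j w)) × toℕ u < toℕ w

-- Directed paths, recorded by their vertex lists:
-- PathVia E v w xs  means  xs = v, …, w  and consecutive vertices are E-edges.
data PathVia {n : ℕ} (E : Fin n → Fin n → Set) : Fin n → Fin n → List (Fin n) → Set where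
  here : ∀ {v} → PathVia E v v (v ∷ [])
  step : ∀ {u x w xs} → E u x → PathVia E x w xs → PathVia E u w (u ∷ xs)

-- min(H): delete each edge (i,j) for which there is a path i,i₁,…,i_k,j with k ≥ 1
-- (i.e. a path with at least 3 vertices).
MinEdge : ∀ {n} → (Fin n → Fin n → Set) → Fin n → Fin n → Set
MinEdge E u w = E u w × (¬ (∃[ xs ] (PathVia E u w xs × 3 ≤ length xs)))

GVertex : ∀ {n} → Subset n → Subset n → Fin n → Set
GVertex = PrecAVertex

GEdge : ∀ {n} → Subset n → Subset n → Fin n → Fin n → Set
GEdge I J = MinEdge (PrecAEdge I J)

{-# OPTIONS --safe #-}
module Submission where

-- Edges of G go up, so a path from v to w is determined by its first vertex after v.
-- If two paths left v through x < y, the edge v → y would jump over x, which has an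
-- incoming edge (so x is some prec(j̄)) and an outgoing one (so x ∈ I); then
-- v → x → y is a path of length two in prec(A(I,J̄)) and v → y is not an edge of its
-- minimisation.

open import Defs
open import Data.Nat using (ℕ; _<_; _≤_; s≤s; z≤n)
open import Data.Nat.Properties using (<-cmp; <-irrefl; <-≤-trans; ≤-refl; <⇒≤)
open import Data.Fin using (Fin; toℕ)
open import Data.Fin.Properties using (toℕ-injective)
open import Data.Fin.Subset using (Subset; _∈_)
open import Data.List using (List; _∷_)
open import Data.Product using (_,_; ∃; _×_)
open import Data.Empty using (⊥; ⊥-elim)
open import Relation.Binary using (tri<; tri≈; tri>)
open import Relation.Binary.PropositionalEquality using (_≡_; refl; cong)

Ascending : ∀ {n} → (Fin n → Fin n → Set) → Set
Ascending G = ∀ {u w} → G u w → toℕ u < toℕ w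

NoJumpOverInterior : ∀ {n} → (Fin n → Fin n → Set) → Set
NoJumpOverInterior G =
  ∀ {u w a y b} → G u w → G a y → G y b → toℕ u < toℕ y → toℕ y < toℕ w → ⊥

BipartiteOrder : ∀ {n} → (Fin n → Set) → (Fin n → Set) → Fin n → Fin n → Set
BipartiteOrder S T u w = S u × T w × toℕ u < toℕ w

module _ {n : ℕ} {G : Fin n → Fin n → Set} (ascending : Ascending G) where

  path-ascending : ∀ {x w xs} → PathVia G x w xs → toℕ x ≤ toℕ w
  path-ascending here       = ≤-refl
  path-ascending (step e r) = <⇒≤ (<-≤-trans (ascending e) (path-ascending r))

  nontrivial-path-starts : ∀ {x w xs} → PathVia G x w xs → toℕ x < toℕ w → ∃ λ z → G x z
  nontrivial-path-starts here       x<x = ⊥-elim (<-irrefl refl x<x)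
  nontrivial-path-starts (step e _) _   = _ , e

  path-unique : NoJumpOverInterior G →
                ∀ {v w p q} → PathVia G v w p → PathVia G v w q → p ≡ q
  path-unique _ here here = refl
  path-unique _ here (step e r) = ⊥-elim (<-irrefl refl (<-≤-trans (ascending e) (path-ascending r)))
  path-unique _ (step e r) here = ⊥-elim (<-irrefl refl (<-≤-trans (ascending e) (path-ascending r)))
  path-unique noJump (step {x = x} e r) (step {x = y} e′ r′) with <-cmp (toℕ x) (toℕ y)
  ... | tri< x<y _ _ =
    let _ , x→ = nontrivial-path-starts r (<-≤-trans x<y (path-ascending r′))
    in ⊥-elim (noJump e′ e x→ (ascending e) x<y)
  ... | tri> _ _ y<x =
    let _ , y→ = nontrivial-path-starts r′ (<-≤-trans y<x (path-ascending r))
    in ⊥-elim (noJump e e′ y→ (ascending e′) y<x)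
  ... | tri≈ _ x≡y _ with toℕ-injective x≡y
  ... | refl = cong (_ ∷_) (path-unique noJump r r′)

minEdge-ascending : ∀ {n} {E : Fin n → Fin n → Set} → Ascending E → Ascending (MinEdge E)
minEdge-ascending ascending (e , _) = ascending e

bipartiteOrder-ascending : ∀ {n} (S T : Fin n → Set) → Ascending (BipartiteOrder S T)
bipartiteOrder-ascending S T (_ , _ , u<w) = u<w

minEdge-bipartiteOrder-noJump : ∀ {n} (S T : Fin n → Set) →
                                NoJumpOverInterior (MinEdge (BipartiteOrder S T))
minEdge-bipartiteOrder-noJump S T ((Su , Tw , _) , noDetour) ((_ , Ty , _) , _) ((Sy , _ , _) , _) u<y y<w =
  noDetour (_ , step (Su , Ty , u<y) (step (Sy , Tw , y<w) here) , s≤s (s≤s (s≤s z≤n)))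

lemma3p5 : (n : ℕ) (I J : Subset n) → Valid I J →
    (v w : Fin n) → GVertex I J v → GVertex I J w → toℕ v < toℕ w →
    (p q : List (Fin n)) → PathVia (GEdge I J) v w p → PathVia (GEdge I J) v w q → p ≡ q
lemma3p5 n I J _ v w _ _ _ p q =
  path-unique (minEdge-ascending (bipartiteOrder-ascending S T))
              (minEdge-bipartiteOrder-noJump S T)
  where
  -- PrecAEdge I J unfolds to BipartiteOrder S T.
  S T : Fin n → Set
  S u = u ∈ I
  T w = ∃ λ j → j ∈ J × Prec I J j w
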